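{- Let $G=(V,E)$ be a graph on $n$ vertices and let $H\subseteq G$ be a subgraph. Suppose there exists a subgraph $\Gamma\subseteq G-H$ such that for every set $E'\subseteq E(G-H-\Gamma)$ with $|E'|\leq n$ there exists a vertex $v\in V$ (possibly depending on $E'$) satisfying $|N_{G-(\Gamma+E')}(v)\cap B_{\Gamma+E'}(v)|>d_H(v)$. Then $G-H$ is Hamiltonian.
   Context: All subgraphs are spanning. For graphs $A,B$ on the same vertex set, $A-B$ is the graph with edge set $E(A)\setminus E(B)$, and $\Gamma+E'$ is the graph obtained from $\Gamma$ by adding the edges of $E'$. $N_G(v)$ is the neighborhood of $v$ in $G$ and $d_H(v)$ the degree of $v$ in $H$. $\ell(G)$ denotes the length (number of edges) of a longest path in $G$. A non-edge $\{u,v\}\notin E(G)$ is a booster with respect to $G$ if $G+\{u,v\}$ is Hamiltonian or $\ell(G+\{u,v\})>\ell(G)$. For $v\in V$, $B_G(v)=\{w\notin N_G(v)\cup\{v\}: \{v,w\}\text{ is a booster with respect to } G\}$. -}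

module Defs where

open import Data.Nat using (ℕ; _<_; _≤_; _∸_)
open import Data.Fin using (Fin)
open import Data.Fin.Properties using (_≟_)
open import Data.Bool using (Bool; true; false; _∧_; _∨_; not)
open import Data.List using (List; []; _∷_; _++_; length; allFin; filterᵇ)
open import Data.Bool.ListAction using (any)
open import Data.Unit using (⊤)
open import Data.List.Relation.Unary.All using (All)
open import Data.List.Relation.Unary.Unique.Propositional using (Unique)
open import Data.Product using (Σ; _×_; _,_)
open import Data.Sum using (_⊎_)
open import Relation.Binary.PropositionalEquality using (_≡_; _≢_)
open import Relation.Nullary.Decidable using (⌊_⌋)

Graph : ℕ → Set
Graph n = Fin n → Fin n → Bool

record IsSimple {n : ℕ} (G : Graph n) : Set where
  field
    symm    : ∀ u v → G u v ≡ G v u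
    irrefl  : ∀ u → G u u ≡ false

_⊆ᴳ_ : {n : ℕ} → Graph n → Graph n → Set
A ⊆ᴳ B = ∀ u v → A u v ≡ true → B u v ≡ true

_-ᴳ_ : {n : ℕ} → Graph n → Graph n → Graph n
(A -ᴳ B) u v = A u v ∧ not (B u v)

-- An edge set given as a list of (unordered) pairs.
EdgeList : ℕ → Set
EdgeList n = List (Fin n × Fin n)

inEdges : {n : ℕ} → EdgeList n → Fin n → Fin n → Bool
inEdges E u v = any (λ { (a , b) → (⌊ a ≟ u ⌋ ∧ ⌊ b ≟ v ⌋) ∨ (⌊ a ≟ v ⌋ ∧ ⌊ b ≟ u ⌋) }) E

_+ᴳ_ : {n : ℕ} → Graph n → EdgeList n → Graph n
(Γ +ᴳ E) u v = Γ u v ∨ inEdges E u v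

Chain : {n : ℕ} → Graph n → List (Fin n) → Set
Chain G []            = ⊤
Chain G (x ∷ [])      = ⊤
Chain G (x ∷ y ∷ xs)  = (G x y ≡ true) × Chain G (y ∷ xs)

record Path {n : ℕ} (G : Graph n) : Set where
  constructor mkPath
  field
    start    : Fin n
    rest     : List (Fin n)
    distinct : Unique (start ∷ rest)
    chain    : Chain G (start ∷ rest)

-- Length of a path = number of edges.
pathLength : {n : ℕ} {G : Graph n} → Path G → ℕ
pathLength p = length (Path.rest p)

LongerPath : {n : ℕ} → Graph n → Graph n → Set
LongerPath G' G = Σ (Path G') λ p → ∀ (q : Path G) → pathLength q < pathLength p

Hamiltonian : {n : ℕ} → Graph n → Set
Hamiltonian {n} G =
  Σ (Fin n) λ x → Σ (List (Fin n)) λ rest →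
    Unique (x ∷ rest) × length (x ∷ rest) ≡ n × 3 ≤ n × Chain G (x ∷ rest ++ x ∷ [])

Booster : {n : ℕ} → Graph n → Fin n → Fin n → Set
Booster G u v =
  u ≢ v × G u v ≡ false ×
  (Hamiltonian (G +ᴳ ((u , v) ∷ [])) ⊎ LongerPath (G +ᴳ ((u , v) ∷ [])) G)

InB : {n : ℕ} → Graph n → Fin n → Fin n → Set
InB G v w = w ≢ v × G v w ≡ false × Booster G v w

deg : {n : ℕ} → Graph n → Fin n → ℕ
deg {n} H v = length (filterᵇ (H v) (allFin n))

IntersectionExceeds : {n : ℕ} → Graph n → Graph n → Fin n → ℕ → Set
IntersectionExceeds {n} A Γ v d =
  Σ (List (Fin n)) λ ws →
    Unique ws × All (λ w → A v w ≡ true × InB Γ v w) ws × d < length ws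

-- Starting from E' = ∅, the hypothesis yields a vertex v with more boosters w ∈ N_{G-(Γ+E')}(v)
-- than H-neighbours, hence one with vw ∉ E(H); vw is then an edge of G - H - Γ outside E' and a
-- booster of Γ + E'. Adding it either makes Γ + E' (a subgraph of G - H) Hamiltonian, or strictly
-- increases its longest path. Since |E'| ≤ ℓ(Γ + E') < n is maintained, the second alternative
-- cannot recur more than n times.
module Submission where

open import Defs
open import Data.Nat using (ℕ; zero; suc; _≤_; _<_; _+_; z≤n; s≤s)
open import Data.Nat.Properties using (≤-refl; <⇒≤; <⇒≱; ≤-<-trans; +-suc; +-identityʳ)
open import Data.Fin using (Fin)
open import Data.Fin.Properties using (_≟_)
open import Data.Bool using (true; false; T; T?; _∧_; _∨_; not)
open import Data.Bool.Properties using (T-≡; T-∨; T-∧; ∧-conicalˡ; ∨-conicalˡ; ∨-assoc; ∨-comm; ∨-identityʳ; ¬-not)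
import Data.Bool.Properties as Bool
open import Data.List using (List; []; _∷_; length; allFin)
open import Data.List.Properties using (length-tabulate; length-removeAt′)
open import Data.List.Relation.Unary.All as All using (All; []; _∷_; lookupAny)
open import Data.List.Relation.Unary.All.Properties using (¬Any⇒All¬)
open import Data.List.Relation.Unary.Any using (Any; here; there; any?; _─_)
open import Data.List.Relation.Unary.AllPairs using ([]; _∷_)
open import Data.List.Relation.Unary.Unique.Propositional using (Unique)
open import Data.List.Membership.Propositional using (_∈_)
open import Data.List.Membership.Propositional.Properties using (∈-allFin; ∈-filter⁺)
open import Data.List.Relation.Binary.Subset.Propositional using (_⊆_)
open import Data.Product using (Σ; ∃₂; _×_; _,_; proj₁; proj₂)
import Data.Product as Product
open import Data.Sum using (_⊎_; inj₁; inj₂)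
import Data.Sum as Sum
open import Data.Unit using (tt)
open import Function using (_∘_; Equivalence)
open import Relation.Nullary using (yes; no; contradiction)
open import Relation.Nullary.Decidable using (⌊_⌋; toWitness)
open import Relation.Binary.PropositionalEquality using (_≡_; _≢_; refl; sym; trans; cong; cong₂; subst; ≢-sym; module ≡-Reasoning)

∈-─⁺ : ∀ {A : Set} {x y : A} {ys} (x∈ys : x ∈ ys) → y ∈ ys → y ≢ x → y ∈ (ys ─ x∈ys)
∈-─⁺ (here refl) (here refl) y≢x = contradiction refl y≢x
∈-─⁺ (here _)    (there y∈ys) _  = y∈ys
∈-─⁺ (there _)   (here y≡z)  _   = here y≡z
∈-─⁺ (there x∈ys) (there y∈ys) y≢x = there (∈-─⁺ x∈ys y∈ys y≢x)

Unique∧⊆⇒length≤ : ∀ {A : Set} {xs ys : List A} → Unique xs → xs ⊆ ys → length xs ≤ length ys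
Unique∧⊆⇒length≤ {xs = []} _ _ = z≤n
Unique∧⊆⇒length≤ {xs = x ∷ xs} {ys} (x∉xs ∷ xs-unique) xs⊆ys =
  subst (suc (length xs) ≤_) (sym (length-removeAt′ ys _))
    (s≤s (Unique∧⊆⇒length≤ xs-unique
      (λ z∈xs → ∈-─⁺ x∈ys (xs⊆ys (there z∈xs)) (≢-sym (All.lookup x∉xs z∈xs)))))
  where x∈ys = xs⊆ys (here refl)

module _ {n : ℕ} where

  Chain-mono : {A B : Graph n} → A ⊆ᴳ B → ∀ xs → Chain A xs → Chain B xs
  Chain-mono A⊆B []           _         = tt
  Chain-mono A⊆B (x ∷ [])     _         = tt
  Chain-mono A⊆B (x ∷ y ∷ xs) (xy , ch) = A⊆B x y xy , Chain-mono A⊆B (y ∷ xs) ch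

  Hamiltonian-mono : {A B : Graph n} → A ⊆ᴳ B → Hamiltonian A → Hamiltonian B
  Hamiltonian-mono A⊆B (x , rest , uniq , len , 3≤n , ch) = x , rest , uniq , len , 3≤n , Chain-mono A⊆B _ ch

  Path-mono : {A B : Graph n} → A ⊆ᴳ B → Path A → Path B
  Path-mono A⊆B (mkPath x rest uniq ch) = mkPath x rest uniq (Chain-mono A⊆B _ ch)

  pathLength<n : {A : Graph n} (p : Path A) → pathLength p < n
  pathLength<n (mkPath x rest uniq _) =
    subst (suc (length rest) ≤_) (length-tabulate {n = n} (λ i → i))
      (Unique∧⊆⇒length≤ uniq (λ {v} _ → ∈-allFin v))

  Unique-neighbours⇒length≤deg : (H : Graph n) (v : Fin n) {ws : List (Fin n)} →
    Unique ws → All (λ w → H v w ≡ true) ws → length ws ≤ deg H v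
  Unique-neighbours⇒length≤deg H v ws-unique ws-adj = Unique∧⊆⇒length≤ ws-unique
    (λ {w} w∈ws → ∈-filter⁺ (T? ∘ H v) (∈-allFin w) (Equivalence.from T-≡ (All.lookup ws-adj w∈ws)))

  non-neighbour : (H : Graph n) (v : Fin n) {ws : List (Fin n)} →
    Unique ws → deg H v < length ws → Any (λ w → H v w ≡ false) ws
  non-neighbour H v {ws} ws-unique deg<|ws| with any? (λ w → H v w Bool.≟ false) ws
  ... | yes found = found
  ... | no  none  = contradiction
    (Unique-neighbours⇒length≤deg H v ws-unique (All.map ¬-not (¬Any⇒All¬ ws none)))
    (<⇒≱ deg<|ws|)

  Symmetric : Graph n → Set
  Symmetric A = ∀ x y → A x y ≡ A y x

  -ᴳ-symmetric : {A B : Graph n} → Symmetric A → Symmetric B → Symmetric (A -ᴳ B)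
  -ᴳ-symmetric A-sym B-sym x y = cong₂ (λ a b → a ∧ not b) (A-sym x y) (B-sym x y)

  -ᴳ-edge : {A B : Graph n} {x y : Fin n} → A x y ≡ true → B x y ≡ false → (A -ᴳ B) x y ≡ true
  -ᴳ-edge Axy Bxy rewrite Axy | Bxy = refl

  EdgesOf : Graph n → EdgeList n → Set
  EdgesOf A = All (λ e → A (proj₁ e) (proj₂ e) ≡ true)

  sameEdge⁻ : {a b x y : Fin n} →
    T ((⌊ a ≟ x ⌋ ∧ ⌊ b ≟ y ⌋) ∨ (⌊ a ≟ y ⌋ ∧ ⌊ b ≟ x ⌋)) → (a ≡ x × b ≡ y) ⊎ (a ≡ y × b ≡ x)
  sameEdge⁻ = Sum.map witnesses witnesses ∘ Equivalence.to T-∨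
    where
    witnesses : ∀ {p q r s : Fin n} → T (⌊ p ≟ q ⌋ ∧ ⌊ r ≟ s ⌋) → p ≡ q × r ≡ s
    witnesses {p} {q} {r} {s} =
      Product.map (toWitness {a? = p ≟ q}) (toWitness {a? = r ≟ s}) ∘ Equivalence.to T-∧

  inEdges⊆ : {A : Graph n} → Symmetric A → {E : EdgeList n} → EdgesOf A E →
    ∀ {x y} → T (inEdges E x y) → A x y ≡ true
  inEdges⊆ A-sym {(a , b) ∷ _} (Aab ∷ _) {x} {y} h with Equivalence.to T-∨ h
  ... | inj₁ same with sameEdge⁻ {a} {b} {x} {y} same
  ...   | inj₁ (refl , refl) = Aab
  ...   | inj₂ (refl , refl) = trans (A-sym b a) Aab
  inEdges⊆ A-sym (_ ∷ AE) h | inj₂ h′ = inEdges⊆ A-sym AE h′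

  +ᴳ⊆ : {Γ A : Graph n} → Γ ⊆ᴳ A → Symmetric A → {E : EdgeList n} → EdgesOf A E → (Γ +ᴳ E) ⊆ᴳ A
  +ᴳ⊆ {Γ} Γ⊆A A-sym AE x y h with Γ x y in Γxy
  ... | true  = Γ⊆A x y Γxy
  ... | false = inEdges⊆ A-sym AE (Equivalence.from T-≡ h)

  +ᴳ-∷ : (Γ : Graph n) (E : EdgeList n) (e : Fin n × Fin n) → ((Γ +ᴳ E) +ᴳ (e ∷ [])) ⊆ᴳ (Γ +ᴳ (e ∷ E))
  +ᴳ-∷ Γ E e x y = subst (_≡ true) (∨-rearrange (Γ x y) (inEdges E x y) _)
    where
    ∨-rearrange : ∀ a b c → (a ∨ b) ∨ (c ∨ false) ≡ a ∨ (c ∨ b)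
    ∨-rearrange a b c = begin
      (a ∨ b) ∨ (c ∨ false)  ≡⟨ cong ((a ∨ b) ∨_) (∨-identityʳ c) ⟩
      (a ∨ b) ∨ c            ≡⟨ ∨-assoc a b c ⟩
      a ∨ (b ∨ c)            ≡⟨ cong (a ∨_) (∨-comm b c) ⟩
      a ∨ (c ∨ b)            ∎
      where open ≡-Reasoning

module Boosting {n : ℕ} (G H Γ : Graph n)
  (G-sym : Symmetric G) (H-sym : Symmetric H) (Γ⊆G-H : Γ ⊆ᴳ (G -ᴳ H))
  (hyp : (E' : EdgeList n) → EdgesOf ((G -ᴳ H) -ᴳ Γ) E' → length E' ≤ n →
         Σ (Fin n) λ v → IntersectionExceeds (G -ᴳ (Γ +ᴳ E')) (Γ +ᴳ E') v (deg H v)) where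

  Admissible : EdgeList n → Set
  Admissible = EdgesOf ((G -ᴳ H) -ᴳ Γ)

  Γ+E⊆G-H : {E : EdgeList n} → Admissible E → (Γ +ᴳ E) ⊆ᴳ (G -ᴳ H)
  Γ+E⊆G-H = +ᴳ⊆ Γ⊆G-H (-ᴳ-symmetric G-sym H-sym) ∘ All.map (∧-conicalˡ _ _)

  next-booster : (E : EdgeList n) → Admissible E → length E ≤ n →
    ∃₂ λ v w → Admissible ((v , w) ∷ E) × Booster (Γ +ᴳ E) v w
  next-booster E E-adm |E|≤n with hyp E E-adm |E|≤n
  ... | v , ws , ws-unique , ws-boosters , deg<|ws|
    with (vw∈G-Γ+E , _ , vw∉Γ+E , booster) , vw∉H
           ← lookupAny ws-boosters (non-neighbour H v ws-unique deg<|ws|)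
    = v , _ , vw-adm ∷ E-adm , booster
    where
    vw-adm = -ᴳ-edge {A = G -ᴳ H} {B = Γ}
      (-ᴳ-edge {A = G} {B = H} (∧-conicalˡ (G v _) _ vw∈G-Γ+E) vw∉H) (∨-conicalˡ (Γ v _) _ vw∉Γ+E)

  |E|<n : (E : EdgeList n) (p : Path (Γ +ᴳ E)) → length E ≤ pathLength p → length E < n
  |E|<n E p |E|≤|p| = ≤-<-trans |E|≤|p| (pathLength<n p)

  boost : (k : ℕ) (E : EdgeList n) → Admissible E → (p : Path (Γ +ᴳ E)) →
    length E ≤ pathLength p → n ≤ length E + k → Hamiltonian (G -ᴳ H)
  boost zero E _ p |E|≤|p| n≤|E|+0 =
    contradiction (subst (n ≤_) (+-identityʳ (length E)) n≤|E|+0) (<⇒≱ (|E|<n E p |E|≤|p|))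
  boost (suc k) E E-adm p |E|≤|p| n≤|E|+k+1 with next-booster E E-adm (<⇒≤ (|E|<n E p |E|≤|p|))
  ... | v , w , vwE-adm , _ , _ , inj₁ ham =
    Hamiltonian-mono (λ x y → Γ+E⊆G-H vwE-adm x y ∘ +ᴳ-∷ Γ E (v , w) x y) ham
  ... | v , w , vwE-adm , _ , _ , inj₂ (p′ , longer) =
    boost k ((v , w) ∷ E) vwE-adm (Path-mono (+ᴳ-∷ Γ E (v , w)) p′)
      (≤-<-trans |E|≤|p| (longer p)) (subst (n ≤_) (+-suc (length E) k) n≤|E|+k+1)

-- hyp at E' = ∅ is used only to obtain a starting vertex: n = 0 is not excluded otherwise.
lemma3p4 : (n : ℕ) (G H : Graph n) → IsSimple G → IsSimple H → H ⊆ᴳ G →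
    (Σ (Graph n) λ Γ → IsSimple Γ × Γ ⊆ᴳ (G -ᴳ H) ×
      ((E' : EdgeList n) →
        All (λ e → ((G -ᴳ H) -ᴳ Γ) (Data.Product.proj₁ e) (Data.Product.proj₂ e) ≡ true) E' →
        length E' ≤ n →
        Σ (Fin n) λ v →
          IntersectionExceeds (G -ᴳ (Γ +ᴳ E')) (Γ +ᴳ E') v (deg H v))) →
    Hamiltonian (G -ᴳ H)
lemma3p4 n G H G-simple H-simple _ (Γ , _ , Γ⊆G-H , hyp) with v , _ ← hyp [] [] z≤n =
  boost n [] [] (mkPath v [] ([] ∷ []) tt) z≤n ≤-refl
  where open Boosting G H Γ (IsSimple.symm G-simple) (IsSimple.symm H-simple) Γ⊆G-H hyp
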